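{- Let $G$ be a graph. If every connected component of $G$ has a $2$-cosplit of size at most $N$ and height at most $h$, then $G$ has a $2$-cosplit of size at most $N$ and height at most $h+1$.
   Context: A cograph of height at most $h$ is a graph defined by a cotree: a rooted tree of height at most $h$ (max edges on a root-to-leaf path) whose leaves are the vertices, with $f:I(T)\to\{0,1\}$ on internal vertices, distinct leaves $u,v$ adjacent iff $f(u\wedge v)=1$ ($u\wedge v$ lowest common ancestor). A bi-cograph of height at most $h$ is a bipartite graph defined by a bi-cotree: a rooted tree of height at most $h$ whose leaves are the vertices colored $1,2$ by side, with $f:I(T)\times[2]\times[2]\to\{0,1\}$ symmetric in the last two arguments, $f(x,1,1)=f(x,2,2)=0$, $u,v$ adjacent iff $f(u\wedge v,c(u),c(v))=1$. For disjoint $A,B$, $G[A,B]$ is the bipartite graph with sides $A,B$ and the edges of $G$ between them. A $2$-cosplit of $G$ is a partition $\mathscr{P}$ of $V(G)$ with $G[A]$ a cograph for each $A\in\mathscr{P}$ and $G[A,B]$ a bi-cograph for distinct $A,B\in\mathscr{P}$; size $|\mathscr{P}|$; height at most $h$ if all these cographs and bi-cographs have height at most $h$. (When $G$ is bipartite, a $2$-cosplit is additionally required to have every part contained in one side.) -}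

module Defs where

open import Data.Nat using (ℕ; zero; suc; _≤_)
open import Data.Fin using (Fin)
open import Data.Bool using (Bool; true; false)
open import Data.List using (List; []; _∷_; _++_; map; length; lookup)
open import Data.List.Relation.Unary.All using (All)
open import Data.List.Relation.Unary.Unique.Propositional using (Unique)
open import Data.List.Membership.Propositional using (_∈_)
open import Data.Product using (Σ; ∃; _×_; _,_; proj₁)
open import Data.Sum using (_⊎_)
open import Relation.Binary.PropositionalEquality using (_≡_; _≢_)
open import Function.Bundles using (_⇔_)

record Graph : Set where
  field
    n     : ℕ
    adj   : Fin n → Fin n → Bool
    sym   : ∀ u v → adj u v ≡ adj v u
    irrefl : ∀ v → adj v v ≡ false

VSet : Graph → Set₁
VSet G = Fin (Graph.n G) → Set

data Tree (X L : Set) : Set where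
  leaf : L → Tree X L
  node : X → List (Tree X L) → Tree X L

mutual
  leaves : ∀ {X L} → Tree X L → List L
  leaves (leaf x)    = x ∷ []
  leaves (node _ ts) = leavesF ts

  leavesF : ∀ {X L} → List (Tree X L) → List L
  leavesF []       = []
  leavesF (t ∷ ts) = leaves t ++ leavesF ts

-- t is a genuine rooted tree (every internal vertex has a child)
-- of height at most h (max number of edges on a root-to-leaf path)
data Height≤ {X L : Set} : ℕ → Tree X L → Set where
  leaf : ∀ {h x} → Height≤ h (leaf x)
  node : ∀ {h b ts} → ts ≢ [] → All (Height≤ h) ts → Height≤ (suc h) (node b ts)

data LCA {X L : Set} : Tree X L → L → L → X → Set where
  here : ∀ {b ts u v} (i j : Fin (length ts)) → i ≢ j →
         u ∈ leaves (lookup ts i) → v ∈ leaves (lookup ts j) →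
         LCA (node b ts) u v b
  down : ∀ {b b' ts u v} (i : Fin (length ts)) →
         LCA (lookup ts i) u v b' → LCA (node b ts) u v b'

IsCograph : (G : Graph) → ℕ → VSet G → Set
IsCograph G h A =
  Σ (Tree Bool (Fin (Graph.n G))) λ t →
    Height≤ h t
  × Unique (leaves t)
  × (∀ v → (v ∈ leaves t) ⇔ A v)
  × (∀ u v → u ∈ leaves t → v ∈ leaves t → u ≢ v →
       (Graph.adj G u v ≡ true) ⇔ LCA t u v true)

-- Bi-cographs: G[A,B] is a bi-cograph of height at most h.
-- Leaves are labelled by (vertex , colour); colour 0 = side A, colour 1 = side B.

BiLabel : Set
BiLabel = Fin 2 → Fin 2 → Bool

ValidBiLabel : BiLabel → Set
ValidBiLabel f = (∀ c d → f c d ≡ f d c) × (∀ c → f c c ≡ false)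

data AllLabels {X L : Set} (P : X → Set) : Tree X L → Set where
  leaf : ∀ {x} → AllLabels P (leaf x)
  node : ∀ {b ts} → P b → All (AllLabels P) ts → AllLabels P (node b ts)

Side : (G : Graph) → VSet G → VSet G → Fin 2 → VSet G
Side G A B Fin.zero    = A
Side G A B (Fin.suc _) = B

BiAdj : (G : Graph) → VSet G → VSet G → Fin (Graph.n G) → Fin (Graph.n G) → Set
BiAdj G A B u v = ((A u × B v) ⊎ (B u × A v)) × (Graph.adj G u v ≡ true)

IsBiCograph : (G : Graph) → ℕ → VSet G → VSet G → Set
IsBiCograph G h A B =
  Σ (Tree BiLabel (Fin (Graph.n G) × Fin 2)) λ t →
    Height≤ h t
  × AllLabels ValidBiLabel t
  × Unique (map proj₁ (leaves t))
  × (∀ v c → ((v , c) ∈ leaves t) ⇔ Side G A B c v)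
  × (∀ u cu v cv → (u , cu) ∈ leaves t → (v , cv) ∈ leaves t → u ≢ v →
       BiAdj G A B u v ⇔ (∃ λ f → LCA t (u , cu) (v , cv) f × f cu cv ≡ true))

record Cosplit (G : Graph) (S : VSet G) (N h : ℕ) : Set₁ where
  field
    k     : ℕ
    k≤N   : k ≤ N
    σ     : Fin (Graph.n G) → Fin k
  part : Fin k → VSet G
  part i v = S v × σ v ≡ i
  field
    nonempty : ∀ i → ∃ λ v → part i v
    cograph  : ∀ i → IsCograph G h (part i)
    bicograph : ∀ i j → i ≢ j → IsBiCograph G h (part i) (part j)

data Reach (G : Graph) (u : Fin (Graph.n G)) : Fin (Graph.n G) → Set where
  refl : Reach G u u
  step : ∀ {v w} → Reach G u v → Graph.adj G v w ≡ true → Reach G u w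

IsComponent : (G : Graph) → VSet G → Set
IsComponent G C = ∃ λ v₀ → C v₀ × (∀ v → C v ⇔ Reach G v₀ v)

AllVertices : (G : Graph) → VSet G
AllVertices G _ = Data.Unit.⊤
  where import Data.Unit

-- Give every vertex the part it has in the cosplit of its own connected component,
-- components being named by a canonical representative; with K the largest size of
-- these cosplits this partitions G into K ≤ N nonempty parts. As no edge leaves a
-- component, G[Part i] is the disjoint union of the cographs G[C ∩ Part i], so a new
-- root labelled 0 above their cotrees is a cotree of it; likewise a new root labelled
-- with the zero function, above bi-cotrees of the G[C ∩ Part i, C ∩ Part j], is a
-- bi-cotree of G[Part i, Part j]. A component meeting only one of the two parts has
-- no edges there and contributes its cotree of that part, recoloured and with every
-- label zero. The new roots add one to the height.

module Submission where

open import Defs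
open import Data.Nat using (ℕ; zero; suc; _<_; _≤_; z≤n; _<?_)
open import Data.Nat.Properties using (n≮0)
open import Data.Fin using (Fin; zero; suc; toℕ; fromℕ<; inject≤) renaming (_≟_ to _≟ᶠ_)
open import Data.Fin.Properties using (0≢1+n; any?; toℕ<n; toℕ-fromℕ<; toℕ-inject≤; toℕ-injective)
open import Data.Fin.Subset using (Subset; ⁅_⁆; _∪_; _⊂_; _⊃_) renaming (_∈_ to _∈ₛ_; _∉_ to _∉ₛ_)
open import Data.Fin.Subset.Properties using (x∈⁅x⁆; x∈⁅y⁆⇒x≡y; p⊆p∪q; q⊆p∪q; x∈p∪q⁻) renaming (_∈?_ to _∈ₛ?_)
open import Data.Fin.Subset.Induction using (⊃-wellFounded)
open import Induction.WellFounded using (Acc; acc)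
open import Data.Bool using (Bool; true; false; if_then_else_)
import Data.Bool.Properties as Bool
open import Data.Maybe using (Maybe; just; nothing; fromMaybe)
import Data.Maybe as Maybe
open import Data.List using (List; []; _∷_; _++_; map; allFin)
open import Data.List.Properties using (map-++; map-∘; map-id)
open import Data.List.Relation.Unary.All as All using (All; []; _∷_)
open import Data.List.Relation.Unary.All.Properties using () renaming (map⁺ to All-map⁺)
open import Data.List.Relation.Unary.AllPairs using (AllPairs; []; _∷_)
open import Data.List.Relation.Unary.Any using (here; there; index)
open import Data.List.Relation.Unary.Any.Properties using (lookup-index; ¬Any[])
open import Data.List.Relation.Unary.Unique.Propositional using (Unique)
open import Data.List.Relation.Unary.Unique.Propositional.Properties using (++⁺; allFin⁺)
open import Data.List.Relation.Binary.Disjoint.Propositional using (Disjoint)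
open import Data.List.Membership.Propositional using (_∈_)
open import Data.List.Membership.Propositional.Properties using (∈-++⁺ˡ; ∈-++⁺ʳ; ∈-++⁻; ∈-map⁺; ∈-map⁻; ∈-lookup; ∈-allFin)
open import Data.List.Extrema.Nat using (max; argmax-sel; xs≤max; max≤v⁺)
open import Data.Product using (Σ; ∃; ∃₂; _×_; _,_; proj₁; proj₂)
open import Data.Sum using (_⊎_; inj₁; inj₂)
import Data.Sum as Sum
import Data.Product as Prod
open import Data.Empty using (⊥-elim)
open import Data.Unit using (tt)
open import Function using (_∘_; id)
open import Function.Bundles using (_⇔_; mk⇔; Equivalence)
import Function.Properties.Equivalence as ⇔
open import Relation.Nullary using (Dec; yes; no; ¬_; ¬?; does)
open import Relation.Nullary.Decidable using (map′; decidable-stable; does-⇔; _×-dec_; _⊎-dec_)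
open import Relation.Unary using (Decidable)
open import Relation.Binary.PropositionalEquality using (_≡_; _≢_; refl; sym; trans; cong; cong₂; subst; module ≡-Reasoning)

open Equivalence using (to; from)

-- Component representatives

first : ∀ {m} {P : Fin m → Set} → Decidable P → Maybe (Fin m)
first {zero}  P? = nothing
first {suc m} P? = if does (P? zero) then just zero else Maybe.map suc (first (P? ∘ suc))

first-cong : ∀ {m} {P Q : Fin m → Set} (P? : Decidable P) (Q? : Decidable Q) →
             (∀ x → P x ⇔ Q x) → first P? ≡ first Q?
first-cong {zero}  P? Q? P⇔Q = refl
first-cong {suc m} P? Q? P⇔Q =
  cong₂ (λ b r → if b then just zero else Maybe.map suc r)
        (does-⇔ (P⇔Q zero) (P? zero) (Q? zero))
        (first-cong (P? ∘ suc) (Q? ∘ suc) (P⇔Q ∘ suc))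

first-sound : ∀ {m} {P : Fin m → Set} (P? : Decidable P) {r} → first P? ≡ just r → P r
first-sound {suc m} P? eq with P? zero
first-sound {suc m} P? refl | yes p = p
... | no _ with first (P? ∘ suc) in eq′
first-sound {suc m} P? refl | no _ | just r = first-sound (P? ∘ suc) eq′

first-complete : ∀ {m} {P : Fin m → Set} (P? : Decidable P) {x} → P x → ∃ λ r → first P? ≡ just r
first-complete {suc m} P? px with P? zero
... | yes _ = zero , refl
first-complete {suc m} P? {zero}  px | no ¬p0 = ⊥-elim (¬p0 px)
first-complete {suc m} P? {suc x} px | no _ =
  Prod.map suc (cong (Maybe.map suc)) (first-complete (P? ∘ suc) px)

module Reachability (G : Graph) where
  open Graph G using (n; adj)

  Reach-trans : ∀ {u v w} → Reach G u v → Reach G v w → Reach G u w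
  Reach-trans p refl       = p
  Reach-trans p (step q e) = step (Reach-trans p q) e

  Reach-sym : ∀ {u v} → Reach G u v → Reach G v u
  Reach-sym refl               = refl
  Reach-sym (step {v} {w} p e) = Reach-trans (step refl (trans (Graph.sym G w v) e)) (Reach-sym p)

  Closed : Subset n → Set
  Closed p = ∀ {v w} → v ∈ₛ p → adj v w ≡ true → w ∈ₛ p

  ReachedFrom : Fin n → Subset n → Set
  ReachedFrom u p = ∀ {x} → x ∈ₛ p → Reach G u x

  closed-or-exit : (p : Subset n) → Closed p ⊎ ∃₂ λ v w → v ∈ₛ p × adj v w ≡ true × w ∉ₛ p
  closed-or-exit p with any? (λ v → any? (λ w → v ∈ₛ? p ×-dec (adj v w Bool.≟ true) ×-dec ¬? (w ∈ₛ? p)))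
  ... | yes exit   = inj₂ exit
  ... | no no-exit = inj₁ λ {v} {w} v∈p vw →
    decidable-stable (w ∈ₛ? p) λ w∉p → no-exit (v , w , v∈p , vw , w∉p)

  closure : ∀ {u} p → Acc _⊃_ p → u ∈ₛ p → ReachedFrom u p →
            ∃ λ q → u ∈ₛ q × Closed q × ReachedFrom u q
  closure p (acc rec) u∈p reached with closed-or-exit p
  ... | inj₁ closed = p , u∈p , closed , reached
  ... | inj₂ (v , w , v∈p , vw , w∉p) =
    closure (p ∪ ⁅ w ⁆) (rec grows) (p⊆p∪q ⁅ w ⁆ u∈p) reached′
    where
    grows : p ⊂ p ∪ ⁅ w ⁆
    grows = p⊆p∪q ⁅ w ⁆ , w , q⊆p∪q p ⁅ w ⁆ (x∈⁅x⁆ w) , w∉p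
    reached′ : ReachedFrom _ (p ∪ ⁅ w ⁆)
    reached′ x∈ with x∈p∪q⁻ p ⁅ w ⁆ x∈
    ... | inj₁ x∈p = reached x∈p
    ... | inj₂ x∈w with refl ← x∈⁅y⁆⇒x≡y w x∈w = step (reached v∈p) vw

  Closed-reach : ∀ {p u v} → Closed p → u ∈ₛ p → Reach G u v → v ∈ₛ p
  Closed-reach closed u∈p refl       = u∈p
  Closed-reach closed u∈p (step r e) = closed (Closed-reach closed u∈p r) e

  component : ∀ u → ∃ λ q → u ∈ₛ q × Closed q × ReachedFrom u q
  component u = closure ⁅ u ⁆ (⊃-wellFounded _) (x∈⁅x⁆ u) from-u
    where
    from-u : ReachedFrom u ⁅ u ⁆
    from-u x∈ = subst (Reach G u) (sym (x∈⁅y⁆⇒x≡y u x∈)) refl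

  Reach? : ∀ u v → Dec (Reach G u v)
  Reach? u v with component u
  ... | q , u∈q , closed , reached = map′ reached (Closed-reach closed u∈q) (v ∈ₛ? q)

  -- The least vertex reaching v; the default v of fromMaybe is never taken.
  rep : Fin n → Fin n
  rep v = fromMaybe v (first (λ r → Reach? r v))

  rep-reaches : ∀ v → Reach G (rep v) v
  rep-reaches v with first-complete (λ r → Reach? r v) refl
  ... | r , eq = subst (λ x → Reach G x v) (sym (cong (fromMaybe v) eq)) (first-sound _ eq)

  rep-cong : ∀ {u v} → Reach G u v → rep u ≡ rep v
  rep-cong {u} {v} u~v with first-complete (λ r → Reach? r u) refl
  ... | r , eq = trans (cong (fromMaybe u) eq) (sym (cong (fromMaybe v) (trans (sym same) eq)))
    where
    same : first (λ r → Reach? r u) ≡ first (λ r → Reach? r v)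
    same = first-cong _ _ λ x → mk⇔ (λ x~u → Reach-trans x~u u~v) (λ x~v → Reach-trans x~v (Reach-sym u~v))

  rep-idem : ∀ v → rep (rep v) ≡ rep v
  rep-idem v = rep-cong (rep-reaches v)

  rep-adj : ∀ {u v} → adj u v ≡ true → rep u ≡ rep v
  rep-adj uv = rep-cong (step refl uv)

  Reach⇔rep≡ : ∀ {r v} → rep r ≡ r → Reach G r v ⇔ rep v ≡ r
  Reach⇔rep≡ {r} {v} r-rep = mk⇔ (λ r~v → trans (sym (rep-cong r~v)) r-rep)
                                 (λ v-rep → subst (λ x → Reach G x v) v-rep (rep-reaches v))

-- Trees

module _ {X L : Set} where

  ∈-leavesF⁺ : ∀ {x t} {ts : List (Tree X L)} → t ∈ ts → x ∈ leaves t → x ∈ leavesF ts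
  ∈-leavesF⁺ {ts = t ∷ ts} (here refl) x∈ = ∈-++⁺ˡ x∈
  ∈-leavesF⁺ {ts = t ∷ ts} (there t∈) x∈ = ∈-++⁺ʳ (leaves t) (∈-leavesF⁺ t∈ x∈)

  ∈-leavesF⁻ : ∀ {x} (ts : List (Tree X L)) → x ∈ leavesF ts → ∃ λ t → t ∈ ts × x ∈ leaves t
  ∈-leavesF⁻ (t ∷ ts) x∈ with ∈-++⁻ (leaves t) x∈
  ... | inj₁ x∈t  = t , here refl , x∈t
  ... | inj₂ x∈ts = Prod.map₂ (Prod.map₁ there) (∈-leavesF⁻ ts x∈ts)

  leavesF-unique : ∀ {V : Set} (π : L → V) {ts : List (Tree X L)} →
                   All (λ t → Unique (map π (leaves t))) ts →
                   AllPairs (λ t t′ → Disjoint (map π (leaves t)) (map π (leaves t′))) ts →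
                   Unique (map π (leavesF ts))
  leavesF-unique π [] [] = []
  leavesF-unique π {t ∷ ts} (u ∷ us) (d ∷ ds) =
    subst Unique (sym (map-++ π (leaves t) (leavesF ts))) (++⁺ u (leavesF-unique π us ds) disjoint)
    where
    disjoint : Disjoint (map π (leaves t)) (map π (leavesF ts))
    disjoint (y∈t , y∈ts) with ∈-map⁻ π y∈ts
    ... | x , x∈ts , refl with ∈-leavesF⁻ ts x∈ts
    ... | t′ , t′∈ts , x∈t′ = All.lookup d t′∈ts (y∈t , ∈-map⁺ π x∈t′)

  LCA-leaves : ∀ {t : Tree X L} {x y b} → LCA t x y b → x ∈ leaves t × y ∈ leaves t
  LCA-leaves (here {ts = ts} i j _ x∈ y∈) =
    ∈-leavesF⁺ {ts = ts} (∈-lookup i) x∈ , ∈-leavesF⁺ {ts = ts} (∈-lookup j) y∈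
  LCA-leaves (down {ts = ts} i l)         =
    Prod.map (∈-leavesF⁺ {ts = ts} (∈-lookup i)) (∈-leavesF⁺ {ts = ts} (∈-lookup i)) (LCA-leaves l)

  LCA-child : ∀ {b₀ : X} {t : Tree X L} {ts x y b} → t ∈ ts → LCA t x y b → LCA (node b₀ ts) x y b
  LCA-child {x = x} {y} {b} t∈ l = down (index t∈) (subst (λ s → LCA s x y b) (lookup-index t∈) l)

  LCA-node⁻ : ∀ {b₀ : X} {ts : List (Tree X L)} {x y b} → LCA (node b₀ ts) x y b →
              b ≡ b₀ ⊎ ∃ λ (t : Tree X L) → t ∈ ts × LCA t x y b
  LCA-node⁻ (here _ _ _ _ _) = inj₁ refl
  LCA-node⁻ (down i l)       = inj₂ (_ , ∈-lookup i , l)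

  LCA-label : ∀ {Q : X → Set} {t : Tree X L} {x y b} → AllLabels Q t → LCA t x y b → Q b
  LCA-label (node qb _)  (here _ _ _ _ _) = qb
  LCA-label (node _ qts) (down i l)       = LCA-label (All.lookup qts (∈-lookup i)) l

module _ {X L V : Set} (π : L → V) (E : X → L → L → Set) (R : L → L → Set) where

  -- π x is the vertex at leaf x, and E b x y says that label b at x ∧ y makes x, y
  -- adjacent: π = id with E b = (b ≡ true) for cotrees, π = proj₁ for bi-cotrees.
  Realises : Tree X L → Set
  Realises t = ∀ x y → x ∈ leaves t → y ∈ leaves t → π x ≢ π y →
               R x y ⇔ (∃ λ b → LCA t x y b × E b x y)

  node-realises : ∀ {x₀ ts} → (∀ {x y} → ¬ E x₀ x y) → All Realises ts →
                  (∀ {t x y} → t ∈ ts → x ∈ leaves t → y ∈ leavesF ts → R x y → y ∈ leaves t) →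
                  Realises (node x₀ ts)
  node-realises {x₀} {ts} ¬E₀ real closed x y x∈ y∈ πx≢πy = mk⇔ lca-of related
    where
    lca-of : R x y → ∃ λ b → LCA (node x₀ ts) x y b × E b x y
    lca-of xRy with ∈-leavesF⁻ ts x∈
    ... | t , t∈ , x∈t with to (All.lookup real t∈ x y x∈t (closed t∈ x∈t y∈ xRy) πx≢πy) xRy
    ... | b , l , e = b , LCA-child t∈ l , e
    related : (∃ λ b → LCA (node x₀ ts) x y b × E b x y) → R x y
    related (b , l , e) with LCA-node⁻ l
    ... | inj₁ refl = ⊥-elim (¬E₀ e)
    ... | inj₂ (t , t∈ , l′) =
      from (All.lookup real t∈ x y (proj₁ (LCA-leaves l′)) (proj₂ (LCA-leaves l′)) πx≢πy) (b , l′ , e)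

IsJoin : ∀ {L : Set} → Bool → L → L → Set
IsJoin b _ _ = b ≡ true

BiJoins : ∀ {V : Set} → BiLabel → V × Fin 2 → V × Fin 2 → Set
BiJoins f x y = f (proj₂ x) (proj₂ y) ≡ true

cotree⇔realises : ∀ {L : Set} {R : L → L → Set} {t : Tree Bool L} →
                  (∀ x y → x ∈ leaves t → y ∈ leaves t → x ≢ y → R x y ⇔ LCA t x y true) ⇔
                  Realises id IsJoin R t
cotree⇔realises = mk⇔ (λ cotree x y x∈ y∈ x≢y → ⇔.trans (cotree x y x∈ y∈ x≢y) LCA-true⇔)
                      (λ realises x y x∈ y∈ x≢y → ⇔.trans (realises x y x∈ y∈ x≢y) (⇔.sym LCA-true⇔))
  where
  LCA-true⇔ : ∀ {L} {t : Tree Bool L} {x y} → LCA t x y true ⇔ (∃ λ b → LCA t x y b × b ≡ true)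
  LCA-true⇔ = mk⇔ (λ l → true , l , refl) (λ { (true , l , refl) → l })

module _ {X Y L M : Set} (f : X → Y) (g : L → M) where

  mutual
    mapTree : Tree X L → Tree Y M
    mapTree (leaf x)    = leaf (g x)
    mapTree (node b ts) = node (f b) (mapForest ts)

    mapForest : List (Tree X L) → List (Tree Y M)
    mapForest []       = []
    mapForest (t ∷ ts) = mapTree t ∷ mapForest ts

  mutual
    mapTree-height : ∀ {h t} → Height≤ h t → Height≤ h (mapTree t)
    mapTree-height leaf                       = leaf
    mapTree-height (node {ts = ts} ts≢[] hts) = node (ts≢[] ∘ mapForest-[] ts) (mapForest-height hts)

    mapForest-height : ∀ {h ts} → All (Height≤ h) ts → All (Height≤ h) (mapForest ts)
    mapForest-height []         = []
    mapForest-height (ht ∷ hts) = mapTree-height ht ∷ mapForest-height hts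

    mapForest-[] : ∀ ts → mapForest ts ≡ [] → ts ≡ []
    mapForest-[] [] _ = refl

  mutual
    mapTree-labels : ∀ {Q : Y → Set} → (∀ b → Q (f b)) → ∀ t → AllLabels Q (mapTree t)
    mapTree-labels q (leaf x)    = leaf
    mapTree-labels q (node b ts) = node (q b) (mapForest-labels q ts)

    mapForest-labels : ∀ {Q : Y → Set} → (∀ b → Q (f b)) → ∀ ts → All (AllLabels Q) (mapForest ts)
    mapForest-labels q []       = []
    mapForest-labels q (t ∷ ts) = mapTree-labels q t ∷ mapForest-labels q ts

  mutual
    mapTree-leaves : ∀ t → leaves (mapTree t) ≡ map g (leaves t)
    mapTree-leaves (leaf x)    = refl
    mapTree-leaves (node b ts) = mapForest-leaves ts

    mapForest-leaves : ∀ ts → leavesF (mapForest ts) ≡ map g (leavesF ts)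
    mapForest-leaves []       = refl
    mapForest-leaves (t ∷ ts) =
      trans (cong₂ _++_ (mapTree-leaves t) (mapForest-leaves ts)) (sym (map-++ g (leaves t) (leavesF ts)))

module Children {A T : Set} {P : A → Set} (P? : Decidable P) (τ : ∀ a → P a → T) where

  children : List A → List T
  children []       = []
  children (a ∷ as) with P? a
  ... | yes p = τ a p ∷ children as
  ... | no _  = children as

  ∈-children⁻ : ∀ as {t} → t ∈ children as → ∃₂ λ a p → a ∈ as × t ≡ τ a p
  ∈-children⁻ (a ∷ as) t∈ with P? a
  ∈-children⁻ (a ∷ as) (here refl) | yes p = a , p , here refl , refl
  ∈-children⁻ (a ∷ as) (there t∈) | yes _ = Prod.map₂ (Prod.map₂ (Prod.map₁ there)) (∈-children⁻ as t∈)
  ∈-children⁻ (a ∷ as) t∈          | no _  = Prod.map₂ (Prod.map₂ (Prod.map₁ there)) (∈-children⁻ as t∈)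

  ∈-children⁺ : ∀ as {a} → a ∈ as → P a → ∃ λ p → τ a p ∈ children as
  ∈-children⁺ (a ∷ as) a∈ pa with P? a | a∈
  ... | yes p | here refl = p , here refl
  ... | yes _ | there a∈′ = Prod.map₂ there (∈-children⁺ as a∈′ pa)
  ... | no ¬p | here refl = ⊥-elim (¬p pa)
  ... | no _  | there a∈′ = ∈-children⁺ as a∈′ pa

  children-All : ∀ {Q : T → Set} → (∀ a p → Q (τ a p)) → ∀ as → All Q (children as)
  children-All {Q} q as = All.tabulate λ t∈ → holds (∈-children⁻ as t∈)
    where
    holds : ∀ {t} → (∃₂ λ a p → a ∈ as × t ≡ τ a p) → Q t
    holds (a , p , _ , refl) = q a p

  children-AllPairs : ∀ {S : T → T → Set} → (∀ {a a′} p p′ → a ≢ a′ → S (τ a p) (τ a′ p′)) →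
                      ∀ {as} → Unique as → AllPairs S (children as)
  children-AllPairs     s {[]}     []         = []
  children-AllPairs {S} s {a ∷ as} (a∉ ∷ as!) with P? a
  ... | yes p = All.tabulate apart ∷ children-AllPairs s as!
    where
    apart : ∀ {t} → t ∈ children as → S (τ a p) t
    apart t∈ with ∈-children⁻ as t∈
    ... | a′ , p′ , a′∈ , refl = s p p′ (All.lookup a∉ a′∈)
  ... | no _  = children-AllPairs s as!

-- Joining the trees of the components

module Join {X L V : Set} {m : ℕ} (π : L → V) (E : X → L → L → Set) (R : L → L → Set)
            (β : V → Fin m) (S : L → Set) (h : ℕ) where

  record Piece (r : Fin m) : Set where
    field
      tree     : Tree X L
      height   : Height≤ h tree
      unique   : Unique (map π (leaves tree))
      leaves⇔  : ∀ x → x ∈ leaves tree ⇔ (S x × β (π x) ≡ r)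
      realises : Realises π E R tree

  module Joined (R-β : ∀ {x y} → R x y → β (π x) ≡ β (π y))
           {P : Fin m → Set} (P? : Decidable P) (piece : ∀ r → P r → Piece r)
           (S-P : ∀ {x} → S x → P (β (π x))) where

    open Piece
    open Children P? (λ r p → tree (piece r p))

    forest : List (Tree X L)
    forest = children (allFin m)

    joined : X → Tree X L
    joined x₀ = node x₀ forest

    ∈-forest⁻ : ∀ {t} → t ∈ forest → ∃₂ λ r p → t ≡ tree (piece r p)
    ∈-forest⁻ t∈ with ∈-children⁻ (allFin m) t∈
    ... | r , p , _ , eq = r , p , eq

    ∈-forest⁺ : ∀ {x} → S x → ∃ λ t → t ∈ forest × x ∈ leaves t
    ∈-forest⁺ {x} sx with ∈-children⁺ (allFin m) (∈-allFin (β (π x))) (S-P sx)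
    ... | p , t∈ = _ , t∈ , from (leaves⇔ (piece _ p) x) (sx , refl)

    forest-leaves : ∀ x → x ∈ leavesF forest ⇔ S x
    forest-leaves x = mk⇔ in-S in-forest
      where
      in-S : x ∈ leavesF forest → S x
      in-S x∈ with ∈-leavesF⁻ forest x∈
      ... | t , t∈ , x∈t with ∈-forest⁻ t∈
      ... | r , p , refl = proj₁ (to (leaves⇔ (piece r p) x) x∈t)
      in-forest : S x → x ∈ leavesF forest
      in-forest sx with ∈-forest⁺ sx
      ... | t , t∈ , x∈t = ∈-leavesF⁺ t∈ x∈t

    joined-height : ∀ {x₀} → ∃ S → Height≤ (suc h) (joined x₀)
    joined-height (x , sx) with ∈-forest⁺ sx
    ... | t , t∈ , _ = node (λ forest≡[] → ¬Any[] (subst (t ∈_) forest≡[] t∈))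
                            (children-All (λ r p → height (piece r p)) (allFin m))

    joined-labels : ∀ {Q : X → Set} {x₀} → Q x₀ → (∀ r p → AllLabels Q (tree (piece r p))) →
                    AllLabels Q (joined x₀)
    joined-labels q₀ qs = node q₀ (children-All qs (allFin m))

    joined-unique : ∀ {x₀} → Unique (map π (leaves (joined x₀)))
    joined-unique = leavesF-unique π (children-All (λ r p → unique (piece r p)) (allFin m))
                                     (children-AllPairs disjoint (allFin⁺ m))
      where
      block : ∀ {r p y} → y ∈ map π (leaves (tree (piece r p))) → β y ≡ r
      block {r} {p} y∈ with ∈-map⁻ π y∈
      ... | x , x∈ , refl = proj₂ (to (leaves⇔ (piece r p) x) x∈)
      disjoint : ∀ {r r′} p p′ → r ≢ r′ →
                 Disjoint (map π (leaves (tree (piece r p)))) (map π (leaves (tree (piece r′ p′))))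
      disjoint p p′ r≢r′ (y∈ , y∈′) = r≢r′ (trans (sym (block y∈)) (block y∈′))

    joined-realises : ∀ {x₀} → (∀ {x y} → ¬ E x₀ x y) → Realises π E R (joined x₀)
    joined-realises ¬E₀ = node-realises π E R ¬E₀ (children-All (λ r p → realises (piece r p)) (allFin m)) closed
      where
      closed : ∀ {t x y} → t ∈ forest → x ∈ leaves t → y ∈ leavesF forest → R x y → y ∈ leaves t
      closed {y = y} t∈ x∈t y∈ xRy with ∈-forest⁻ t∈
      ... | r , p , refl = from (leaves⇔ (piece r p) y)
        ( to (forest-leaves y) y∈
        , trans (sym (R-β xRy)) (proj₂ (to (leaves⇔ (piece r p) _) x∈t)))

-- The cosplit of G

<max-map⁻ : ∀ {A : Set} (f : A → ℕ) xs {a} → a < max 0 (map f xs) → ∃ λ x → x ∈ xs × a < f x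
<max-map⁻ f xs {a} a<max with argmax-sel id 0 (map f xs)
... | inj₁ max≡0 = ⊥-elim (n≮0 (subst (a <_) max≡0 a<max))
... | inj₂ max∈ with ∈-map⁻ f max∈
... | x , x∈ , max≡fx = x , x∈ , subst (a <_) max≡fx a<max

BiAdj-cong : ∀ {G : Graph} {A B A′ B′ : VSet G} {u v} →
             A u ⇔ A′ u → A v ⇔ A′ v → B u ⇔ B′ u → B v ⇔ B′ v → BiAdj G A B u v ⇔ BiAdj G A′ B′ u v
BiAdj-cong Au Av Bu Bv =
  mk⇔ (Prod.map₁ (Sum.map (Prod.map (to Au) (to Bv)) (Prod.map (to Bu) (to Av))))
      (Prod.map₁ (Sum.map (Prod.map (from Au) (from Bv)) (Prod.map (from Bu) (from Av))))

noEdges : BiLabel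
noEdges _ _ = false

noEdges-valid : ValidBiLabel noEdges
noEdges-valid = (λ _ _ → refl) , (λ _ → refl)

module Assembly (G : Graph) (N h : ℕ)
                (component-cosplit : ∀ C → IsComponent G C → Cosplit G C N h) where
  open Graph G using (n; adj)
  open Reachability G

  cosplit : (r : Fin n) → Cosplit G (Reach G r) N h
  cosplit r = component-cosplit (Reach G r) (r , refl , λ _ → ⇔.refl)

  k : Fin n → ℕ
  k r = Cosplit.k (cosplit r)

  K : ℕ
  K = max 0 (map (k ∘ rep) (allFin n))

  k≤K : ∀ v → k (rep v) ≤ K
  k≤K v = All.lookup (xs≤max 0 (map (k ∘ rep) (allFin n))) (∈-map⁺ (k ∘ rep) (∈-allFin v))

  K≤N : K ≤ N
  K≤N = max≤v⁺ z≤n (All-map⁺ {xs = allFin n} (All.tabulate λ {v} _ → Cosplit.k≤N (cosplit (rep v))))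

  σ : Fin n → Fin K
  σ v = inject≤ (Cosplit.σ (cosplit (rep v)) v) (k≤K v)

  Part : Fin K → VSet G
  Part i v = AllVertices G v × σ v ≡ i

  toℕ-σ : ∀ {r v} → rep v ≡ r → toℕ (σ v) ≡ toℕ (Cosplit.σ (cosplit r) v)
  toℕ-σ {v = v} refl = toℕ-inject≤ _ (k≤K v)

  Part⇒< : ∀ {i v r} → Part i v → rep v ≡ r → toℕ i < k r
  Part⇒< {v = v} {r} (_ , refl) v-rep =
    subst (_< k r) (sym (toℕ-σ v-rep)) (toℕ<n (Cosplit.σ (cosplit r) v))

  σ-agrees : ∀ {r i v} (p : toℕ i < k r) → rep v ≡ r → Cosplit.σ (cosplit r) v ≡ fromℕ< p → σ v ≡ i
  σ-agrees {r} {i} {v} p v-rep eq = toℕ-injective (begin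
    toℕ (σ v)                         ≡⟨ toℕ-σ v-rep ⟩
    toℕ (Cosplit.σ (cosplit r) v)     ≡⟨ cong toℕ eq ⟩
    toℕ (fromℕ< p)                    ≡⟨ toℕ-fromℕ< p ⟩
    toℕ i                             ∎)
    where open ≡-Reasoning

  σᵣ-agrees : ∀ {r i v} (p : toℕ i < k r) → rep v ≡ r → σ v ≡ i → Cosplit.σ (cosplit r) v ≡ fromℕ< p
  σᵣ-agrees {r} {i} {v} p v-rep eq = toℕ-injective (begin
    toℕ (Cosplit.σ (cosplit r) v)     ≡⟨ toℕ-σ v-rep ⟨
    toℕ (σ v)                         ≡⟨ cong toℕ eq ⟩
    toℕ i                             ≡⟨ toℕ-fromℕ< p ⟨
    toℕ (fromℕ< p)                    ∎)
    where open ≡-Reasoning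

  local-part⇔ : ∀ {r i} → rep r ≡ r → (p : toℕ i < k r) → ∀ v →
                Cosplit.part (cosplit r) (fromℕ< p) v ⇔ (Part i v × rep v ≡ r)
  local-part⇔ r-rep p v = mk⇔
    (λ (r~v , σᵣv) → let v-rep = to (Reach⇔rep≡ r-rep) r~v in (tt , σ-agrees p v-rep σᵣv) , v-rep)
    (λ ((_ , σv) , v-rep) → from (Reach⇔rep≡ r-rep) v-rep , σᵣ-agrees p v-rep σv)

  Part⇔local : ∀ {r i v} → rep r ≡ r → (p : toℕ i < k r) → rep v ≡ r →
               Part i v ⇔ Cosplit.part (cosplit r) (fromℕ< p) v
  Part⇔local {v = v} r-rep p v-rep =
    mk⇔ (λ x → from (local-part⇔ r-rep p v) (x , v-rep)) (proj₁ ∘ to (local-part⇔ r-rep p v))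

  Part-nonempty : ∀ i → ∃ (Part i)
  Part-nonempty i = inhabited (<max-map⁻ (k ∘ rep) (allFin n) (toℕ<n i))
    where
    inhabited : (∃ λ v → v ∈ allFin n × toℕ i < k (rep v)) → ∃ (Part i)
    inhabited (v , _ , i<k) = Prod.map₂ (λ {w} → proj₁ ∘ to (local-part⇔ (rep-idem v) i<k w))
                                        (Cosplit.nonempty (cosplit (rep v)) (fromℕ< i<k))

  Edge : Fin n → Fin n → Set
  Edge u v = adj u v ≡ true

  module PartCograph (i : Fin K) where
    open Join id IsJoin Edge rep (Part i) h

    Hosts : Fin n → Set
    Hosts r = rep r ≡ r × toℕ i < k r

    hosts? : Decidable Hosts
    hosts? r = (rep r ≟ᶠ r) ×-dec (toℕ i <? k r)

    Part-hosted : ∀ {v} → Part i v → Hosts (rep v)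
    Part-hosted {v} v∈ = rep-idem v , Part⇒< v∈ refl

    piece : ∀ r → Hosts r → Piece r
    piece r (r-rep , p) = from-cotree (Cosplit.cograph (cosplit r) (fromℕ< p))
      where
      from-cotree : IsCograph G h (Cosplit.part (cosplit r) (fromℕ< p)) → Piece r
      from-cotree (t , ht , t! , leaves-t , cotree) = record
        { tree     = t
        ; height   = ht
        ; unique   = subst Unique (sym (map-id _)) t!
        ; leaves⇔  = λ v → ⇔.trans (leaves-t v) (local-part⇔ r-rep p v)
        ; realises = to cotree⇔realises cotree
        }

    open Joined rep-adj hosts? piece Part-hosted

    isCograph : IsCograph G (suc h) (Part i)
    isCograph = joined false
              , joined-height (Part-nonempty i)
              , subst Unique (map-id _) (joined-unique {false})
              , forest-leaves
              , from cotree⇔realises (joined-realises {false} λ ())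

  module PartsBicograph (i j : Fin K) (i≢j : i ≢ j) where
    A B : VSet G
    A = Part i
    B = Part j

    Sides : Fin n × Fin 2 → Set
    Sides x = Side G A B (proj₂ x) (proj₁ x)

    BiEdge : Fin n × Fin 2 → Fin n × Fin 2 → Set
    BiEdge x y = BiAdj G A B (proj₁ x) (proj₁ y)

    open Join proj₁ BiJoins BiEdge rep Sides h

    BiPiece : Fin n → Set
    BiPiece r = Σ (Piece r) λ pc → AllLabels ValidBiLabel (Piece.tree pc)

    local≢ : ∀ {r} (p : toℕ i < k r) (p′ : toℕ j < k r) → fromℕ< p ≢ fromℕ< p′
    local≢ p p′ eq = i≢j (toℕ-injective
        (trans (sym (toℕ-fromℕ< p)) (trans (cong toℕ eq) (toℕ-fromℕ< p′))))

    module BothSides {r} (r-rep : rep r ≡ r) (p : toℕ i < k r) (p′ : toℕ j < k r) where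
      Aᵣ Bᵣ : VSet G
      Aᵣ = Cosplit.part (cosplit r) (fromℕ< p)
      Bᵣ = Cosplit.part (cosplit r) (fromℕ< p′)

      side⇔ : ∀ c v → Side G Aᵣ Bᵣ c v ⇔ (Side G A B c v × rep v ≡ r)
      side⇔ zero    v = local-part⇔ r-rep p v
      side⇔ (suc _) v = local-part⇔ r-rep p′ v

      adjacent⇔ : ∀ {u v} → rep u ≡ r → rep v ≡ r → BiAdj G A B u v ⇔ BiAdj G Aᵣ Bᵣ u v
      adjacent⇔ u-rep v-rep = BiAdj-cong {G = G} {A} {B} {Aᵣ} {Bᵣ}
        (Part⇔local r-rep p u-rep) (Part⇔local r-rep p v-rep) (Part⇔local r-rep p′ u-rep) (Part⇔local r-rep p′ v-rep)

      from-bicotree : IsBiCograph G h Aᵣ Bᵣ → BiPiece r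
      from-bicotree (t , ht , labels , t! , leaves-t , bicotree) = record
        { tree     = t
        ; height   = ht
        ; unique   = t!
        ; leaves⇔  = λ (v , c) → ⇔.trans (leaves-t v c) (side⇔ c v)
        ; realises = realises
        } , labels
        where
        in-component : ∀ {v c} → (v , c) ∈ leaves t → rep v ≡ r
        in-component {v} {c} v∈ = proj₂ (to (side⇔ c v) (to (leaves-t v c) v∈))

        realises : Realises proj₁ BiJoins BiEdge t
        realises (u , cu) (v , cv) u∈ v∈ u≢v =
          ⇔.trans (adjacent⇔ (in-component u∈) (in-component v∈)) (bicotree u cu v cv u∈ v∈ u≢v)

      piece : BiPiece r
      piece = from-bicotree (Cosplit.bicograph (cosplit r) (fromℕ< p) (fromℕ< p′) (local≢ p p′))

    module OneSided {r} (c : Fin 2) (cotree : Join.Piece id IsJoin Edge rep (Side G A B c) h r)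
             (only-c : ∀ {v c′} → Side G A B c′ v → rep v ≡ r → c′ ≡ c) where
      open Join.Piece cotree using () renaming (tree to t; height to ht; unique to t!; leaves⇔ to leaves-t)

      coloured : Tree BiLabel (Fin n × Fin 2)
      coloured = mapTree (λ _ → noEdges) (_, c) t

      leaves-coloured : leaves coloured ≡ map (_, c) (leaves t)
      leaves-coloured = mapTree-leaves (λ _ → noEdges) (_, c) t

      coloured-leaves⇔ : ∀ x → x ∈ leaves coloured ⇔ (Sides x × rep (proj₁ x) ≡ r)
      coloured-leaves⇔ (v , c′) =
        mk⇔ (uncoloured ∘ ∈-map⁻ (_, c) ∘ subst ((v , c′) ∈_) leaves-coloured) coloured-leaf
        where
        uncoloured : (∃ λ w → w ∈ leaves t × (v , c′) ≡ (w , c)) → Side G A B c′ v × rep v ≡ r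
        uncoloured (w , w∈ , refl) = to (leaves-t w) w∈
        recoloured : c′ ≡ c → Side G A B c′ v → rep v ≡ r → (v , c′) ∈ leaves coloured
        recoloured refl s v-rep =
          subst ((v , c) ∈_) (sym leaves-coloured) (∈-map⁺ (_, c) (from (leaves-t v) (s , v-rep)))
        coloured-leaf : Side G A B c′ v × rep v ≡ r → (v , c′) ∈ leaves coloured
        coloured-leaf (s , v-rep) = recoloured (only-c s v-rep) s v-rep

      side≡c : ∀ {x} c′ → x ∈ leaves coloured → Side G A B c′ (proj₁ x) → c′ ≡ c
      side≡c {x} c′ x∈ s = only-c s (proj₂ (to (coloured-leaves⇔ x) x∈))

      no-edges : ∀ {x y} → x ∈ leaves coloured → y ∈ leaves coloured → ¬ BiEdge x y
      no-edges x∈ y∈ (inj₁ (a , b) , _) = 0≢1+n (trans (side≡c zero x∈ a) (sym (side≡c (suc zero) y∈ b)))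
      no-edges x∈ y∈ (inj₂ (b , a) , _) = 0≢1+n (trans (side≡c zero y∈ a) (sym (side≡c (suc zero) x∈ b)))

      no-joins : ∀ {f x y} → LCA coloured x y f → ¬ BiJoins f x y
      no-joins {x = x} {y} l = subst (λ f → ¬ BiJoins f x y) (sym (LCA-label labels l)) λ ()
        where
        labels : AllLabels (_≡ noEdges) coloured
        labels = mapTree-labels (λ _ → noEdges) (_, c) (λ _ → refl) t

      piece : BiPiece r
      piece = record
        { tree     = coloured
        ; height   = mapTree-height (λ _ → noEdges) (_, c) ht
        ; unique   = subst Unique (sym (trans (cong (map proj₁) leaves-coloured) (sym (map-∘ (leaves t))))) t!
        ; leaves⇔  = coloured-leaves⇔
        ; realises = λ x y x∈ y∈ _ → mk⇔ (⊥-elim ∘ no-edges x∈ y∈) (λ (f , l , e) → ⊥-elim (no-joins l e))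
        } , mapTree-labels (λ _ → noEdges) (_, c) (λ _ → noEdges-valid) t

    Hosts : Fin n → Set
    Hosts r = rep r ≡ r × (toℕ i < k r ⊎ toℕ j < k r)

    hosts? : Decidable Hosts
    hosts? r = (rep r ≟ᶠ r) ×-dec ((toℕ i <? k r) ⊎-dec (toℕ j <? k r))

    Sides-hosted : ∀ {x} → Sides x → Hosts (rep (proj₁ x))
    Sides-hosted {v , zero}  a = rep-idem v , inj₁ (Part⇒< a refl)
    Sides-hosted {v , suc _} b = rep-idem v , inj₂ (Part⇒< b refl)

    only-i : ∀ {r} → ¬ toℕ j < k r → ∀ {v c′} → Side G A B c′ v → rep v ≡ r → c′ ≡ zero
    only-i ¬p′ {c′ = zero}  _ _     = refl
    only-i ¬p′ {c′ = suc _} b v-rep = ⊥-elim (¬p′ (Part⇒< b v-rep))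

    only-j : ∀ {r} → ¬ toℕ i < k r → ∀ {v c′} → Side G A B c′ v → rep v ≡ r → c′ ≡ suc zero
    only-j ¬p {c′ = zero}     a v-rep = ⊥-elim (¬p (Part⇒< a v-rep))
    only-j ¬p {c′ = suc zero}     _ _     = refl

    piece : ∀ r → Hosts r → BiPiece r
    piece r (r-rep , hosted) = choose (toℕ i <? k r) (toℕ j <? k r) hosted
      where
      choose : Dec (toℕ i < k r) → Dec (toℕ j < k r) → toℕ i < k r ⊎ toℕ j < k r → BiPiece r
      choose (yes p) (yes p′) _         = BothSides.piece r-rep p p′
      choose (yes p) (no ¬p′) _         = OneSided.piece zero (PartCograph.piece i r (r-rep , p)) (only-i ¬p′)
      choose (no ¬p) (yes p′) _         = OneSided.piece (suc zero) (PartCograph.piece j r (r-rep , p′)) (only-j ¬p)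
      choose (no ¬p) (no _)   (inj₁ p)  = ⊥-elim (¬p p)
      choose (no _)  (no ¬p′) (inj₂ p′) = ⊥-elim (¬p′ p′)

    open Joined (rep-adj ∘ proj₂) hosts? (λ r p → proj₁ (piece r p)) (λ {x} → Sides-hosted {x})

    isBicograph : IsBiCograph G (suc h) A B
    isBicograph = joined noEdges
                , joined-height {noEdges} (A-leaf (Part-nonempty i))
                , joined-labels noEdges-valid (λ r p → proj₂ (piece r p))
                , joined-unique {noEdges}
                , (λ v c → forest-leaves (v , c))
                , (λ u cu v cv → joined-realises {noEdges} (λ ()) (u , cu) (v , cv))
      where
      A-leaf : ∃ A → ∃ Sides
      A-leaf (v , v∈) = (v , zero) , v∈

lemma5p6 : (G : Graph) (N h : ℕ) →
    (∀ (C : VSet G) → IsComponent G C → Cosplit G C N h) →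
    Cosplit G (AllVertices G) N (suc h)
lemma5p6 G N h component-cosplit = record
  { k         = K
  ; k≤N       = K≤N
  ; σ         = σ
  ; nonempty  = Part-nonempty
  ; cograph   = PartCograph.isCograph
  ; bicograph = PartsBicograph.isBicograph
  }
  where open Assembly G N h component-cosplit
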